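{- The proof systems $\mathcal{G}^c$ and $\mathcal{P}$ (described in the context) for applicative matching logic are equivalent: for every set $\Gamma$ of patterns and every pattern $\varphi$, $\Gamma\vdash_{\mathcal{G}^c}\varphi$ if and only if $\Gamma\vdash_{\mathcal{P}}\varphi$.
   Context: Fix a countably infinite set $EVar$ of element variables and a set $\Sigma$ of constant symbols. Patterns are generated by $\varphi::= x\mid \sigma\mid \bot\mid \neg\varphi\mid \varphi\to\varphi\mid \varphi\wedge\varphi\mid\varphi\vee\varphi\mid \varphi\cdot\varphi\mid \forall x\varphi\mid\exists x\varphi$ ($x\in EVar$, $\sigma\in\Sigma$; $\varphi\cdot\psi$ is "application"). An occurrence of $x$ in $\varphi$ is bound if it lies inside a subpattern $\forall x\psi$ or $\exists x\psi$, otherwise free; $FV(\varphi)$ is the set of variables with a free occurrence. $\mathrm{Subf}_x^y\varphi$ is the result of replacing every free occurrence of $x$ in $\varphi$ by $y$; "$x$ is free for $y$ in $\varphi$" means no free occurrence of $x$ in $\varphi$ lies inside a subpattern of the form $\forall y\psi$ or $\exists y\psi$. For a proof system $S$ (axiom schemes and deduction rules) and a set $\Gamma$ of patterns, $\Gamma\vdash_S\varphi$ means there is a finite sequence of patterns ending with $\varphi$, each an instance of an axiom of $S$, an element of $\Gamma$, or obtained from earlier members by a rule of $S$. System $\mathcal{G}^c$. Axioms (all patterns $\varphi,\psi,\chi$, variables $x,y$): $\varphi\vee\varphi\to\varphi$; $\varphi\to\varphi\wedge\varphi$; $\varphi\to\varphi\vee\psi$; $\varphi\wedge\psi\to\varphi$;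 $\varphi\vee\psi\to\psi\vee\varphi$; $\varphi\wedge\psi\to\psi\wedge\varphi$; $\bot\to\varphi$; $\varphi\vee\neg\varphi$; $\neg\varphi\to(\varphi\to\bot)$; $(\varphi\to\bot)\to\neg\varphi$; $\mathrm{Subf}_x^y\varphi\to\exists x\varphi$ and $\forall x\varphi\to\mathrm{Subf}_x^y\varphi$ whenever $x$ is free for $y$ in $\varphi$; $\varphi\cdot\bot\to\bot$; $\bot\cdot\varphi\to\bot$; $(\varphi\vee\psi)\cdot\chi\to\varphi\cdot\chi\vee\psi\cdot\chi$; $\chi\cdot(\varphi\vee\psi)\to\chi\cdot\varphi\vee\chi\cdot\psi$; $(\exists x\varphi)\cdot\psi\to\exists x(\varphi\cdot\psi)$ and $\psi\cdot(\exists x\varphi)\to\exists x(\psi\cdot\varphi)$ whenever $x$ does not occur in $\psi$. Rules: from $\varphi$ and $\varphi\to\psi$ infer $\psi$; from $\varphi\to\psi$ and $\psi\to\chi$ infer $\varphi\to\chi$; from $\varphi\wedge\psi\to\chi$ infer $\varphi\to(\psi\to\chi)$; from $\varphi\to(\psi\to\chi)$ infer $\varphi\wedge\psi\to\chi$; from $\varphi\to\psi$ infer $\chi\vee\varphi\to\chi\vee\psi$; from $\varphi\to\psi$ infer $\exists x\varphi\to\psi$ if $x\notin FV(\psi)$; from $\varphi\to\psi$ infer $\varphi\to\forall x\psi$ if $x\notin FV(\varphi)$; from $\varphi\to\psi$ infer $\varphi\cdot\chi\to\psi\cdot\chi$ and $\chi\cdot\varphi\to\chi\cdot\psi$. System $\mathcal{P}$.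 Axioms: $\varphi\to(\psi\to\varphi)$; $(\varphi\to(\psi\to\chi))\to((\varphi\to\psi)\to(\varphi\to\chi))$; $\neg\neg\varphi\to\varphi$; $\neg\varphi\to(\varphi\to\bot)$; $(\varphi\to\bot)\to\neg\varphi$; $\varphi\vee\psi\to(\neg\varphi\to\psi)$; $(\neg\varphi\to\psi)\to\varphi\vee\psi$; $\varphi\wedge\psi\to\neg(\neg\varphi\vee\neg\psi)$; $\neg(\neg\varphi\vee\neg\psi)\to\varphi\wedge\psi$; $\mathrm{Subf}_x^y\varphi\to\exists x\varphi$ whenever $x$ is free for $y$ in $\varphi$; $\forall x\varphi\to\neg\exists x\neg\varphi$; $\neg\exists x\neg\varphi\to\forall x\varphi$; $\varphi\cdot\bot\to\bot$; $\bot\cdot\varphi\to\bot$; $(\varphi\vee\psi)\cdot\chi\to\varphi\cdot\chi\vee\psi\cdot\chi$; $\chi\cdot(\varphi\vee\psi)\to\chi\cdot\varphi\vee\chi\cdot\psi$; $(\exists x\varphi)\cdot\psi\to\exists x(\varphi\cdot\psi)$ and $\psi\cdot(\exists x\varphi)\to\exists x(\psi\cdot\varphi)$ whenever $x\notin FV(\psi)$. Rules: modus ponens; from $\varphi\to\psi$ infer $\exists x\varphi\to\psi$ if $x\notin FV(\psi)$; from $\varphi\to\psi$ infer $\varphi\cdot\chi\to\psi\cdot\chi$ and $\chi\cdot\varphi\to\chi\cdot\psi$. -}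

module Defs where

open import Data.Nat using (ℕ; _≟_)
open import Data.Empty using (⊥)
open import Data.Unit using (⊤)
open import Data.Product using (_×_)
open import Data.Sum using (_⊎_)
open import Relation.Nullary using (¬_; yes; no)
open import Relation.Binary.PropositionalEquality using (_≡_; _≢_)

EVar : Set
EVar = ℕ

infixr 4 _⇒_
infixr 5 _∨ₚ_
infixr 6 _∧ₚ_
infixl 7 _·_

data Pattern (C : Set) : Set where
  var  : EVar → Pattern C
  con  : C → Pattern C
  ⊥ₚ   : Pattern C
  ¬ₚ_  : Pattern C → Pattern C
  _⇒_  : Pattern C → Pattern C → Pattern C
  _∧ₚ_ : Pattern C → Pattern C → Pattern C
  _∨ₚ_ : Pattern C → Pattern C → Pattern C
  _·_  : Pattern C → Pattern C → Pattern C
  all  : EVar → Pattern C → Pattern C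
  ex   : EVar → Pattern C → Pattern C

data _∈FV_ {C : Set} (x : EVar) : Pattern C → Set where
  fv-var  : x ∈FV var x
  fv-¬    : ∀ {φ} → x ∈FV φ → x ∈FV (¬ₚ φ)
  fv-⇒l   : ∀ {φ ψ} → x ∈FV φ → x ∈FV (φ ⇒ ψ)
  fv-⇒r   : ∀ {φ ψ} → x ∈FV ψ → x ∈FV (φ ⇒ ψ)
  fv-∧l   : ∀ {φ ψ} → x ∈FV φ → x ∈FV (φ ∧ₚ ψ)
  fv-∧r   : ∀ {φ ψ} → x ∈FV ψ → x ∈FV (φ ∧ₚ ψ)
  fv-∨l   : ∀ {φ ψ} → x ∈FV φ → x ∈FV (φ ∨ₚ ψ)
  fv-∨r   : ∀ {φ ψ} → x ∈FV ψ → x ∈FV (φ ∨ₚ ψ)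
  fv-·l   : ∀ {φ ψ} → x ∈FV φ → x ∈FV (φ · ψ)
  fv-·r   : ∀ {φ ψ} → x ∈FV ψ → x ∈FV (φ · ψ)
  fv-all  : ∀ {z φ} → z ≢ x → x ∈FV φ → x ∈FV all z φ
  fv-ex   : ∀ {z φ} → z ≢ x → x ∈FV φ → x ∈FV ex z φ

data _occursIn_ {C : Set} (x : EVar) : Pattern C → Set where
  oc-var  : x occursIn var x
  oc-¬    : ∀ {φ} → x occursIn φ → x occursIn (¬ₚ φ)
  oc-⇒l   : ∀ {φ ψ} → x occursIn φ → x occursIn (φ ⇒ ψ)
  oc-⇒r   : ∀ {φ ψ} → x occursIn ψ → x occursIn (φ ⇒ ψ)
  oc-∧l   : ∀ {φ ψ} → x occursIn φ → x occursIn (φ ∧ₚ ψ)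
  oc-∧r   : ∀ {φ ψ} → x occursIn ψ → x occursIn (φ ∧ₚ ψ)
  oc-∨l   : ∀ {φ ψ} → x occursIn φ → x occursIn (φ ∨ₚ ψ)
  oc-∨r   : ∀ {φ ψ} → x occursIn ψ → x occursIn (φ ∨ₚ ψ)
  oc-·l   : ∀ {φ ψ} → x occursIn φ → x occursIn (φ · ψ)
  oc-·r   : ∀ {φ ψ} → x occursIn ψ → x occursIn (φ · ψ)
  oc-allb : ∀ {φ} → x occursIn all x φ
  oc-exb  : ∀ {φ} → x occursIn ex x φ
  oc-all  : ∀ {z φ} → x occursIn φ → x occursIn all z φ
  oc-ex   : ∀ {z φ} → x occursIn φ → x occursIn ex z φ

Subf : {C : Set} → EVar → EVar → Pattern C → Pattern C
Subf x y (var z) with x ≟ z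
... | yes _ = var y
... | no  _ = var z
Subf x y (con c) = con c
Subf x y ⊥ₚ = ⊥ₚ
Subf x y (¬ₚ φ) = ¬ₚ (Subf x y φ)
Subf x y (φ ⇒ ψ) = Subf x y φ ⇒ Subf x y ψ
Subf x y (φ ∧ₚ ψ) = Subf x y φ ∧ₚ Subf x y ψ
Subf x y (φ ∨ₚ ψ) = Subf x y φ ∨ₚ Subf x y ψ
Subf x y (φ · ψ) = Subf x y φ · Subf x y ψ
Subf x y (all z φ) with x ≟ z
... | yes _ = all z φ
... | no  _ = all z (Subf x y φ)
Subf x y (ex z φ) with x ≟ z
... | yes _ = ex z φ
... | no  _ = ex z (Subf x y φ)

FreeFor : {C : Set} → EVar → EVar → Pattern C → Set
FreeFor x y (var z) = ⊤
FreeFor x y (con c) = ⊤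
FreeFor x y ⊥ₚ = ⊤
FreeFor x y (¬ₚ φ) = FreeFor x y φ
FreeFor x y (φ ⇒ ψ) = FreeFor x y φ × FreeFor x y ψ
FreeFor x y (φ ∧ₚ ψ) = FreeFor x y φ × FreeFor x y ψ
FreeFor x y (φ ∨ₚ ψ) = FreeFor x y φ × FreeFor x y ψ
FreeFor x y (φ · ψ) = FreeFor x y φ × FreeFor x y ψ
FreeFor x y (all z φ) = z ≡ x ⊎ ((z ≡ y → ¬ (x ∈FV φ)) × FreeFor x y φ)
FreeFor x y (ex z φ) = z ≡ x ⊎ ((z ≡ y → ¬ (x ∈FV φ)) × FreeFor x y φ)

infix 2 _⊢G_ _⊢P_

data _⊢G_ {C : Set} (Γ : Pattern C → Set) : Pattern C → Set where
  hyp      : ∀ {φ} → Γ φ → Γ ⊢G φ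
  ax-∨idem : ∀ {φ} → Γ ⊢G (φ ∨ₚ φ ⇒ φ)
  ax-∧dup  : ∀ {φ} → Γ ⊢G (φ ⇒ φ ∧ₚ φ)
  ax-∨in   : ∀ {φ ψ} → Γ ⊢G (φ ⇒ φ ∨ₚ ψ)
  ax-∧el   : ∀ {φ ψ} → Γ ⊢G (φ ∧ₚ ψ ⇒ φ)
  ax-∨comm : ∀ {φ ψ} → Γ ⊢G (φ ∨ₚ ψ ⇒ ψ ∨ₚ φ)
  ax-∧comm : ∀ {φ ψ} → Γ ⊢G (φ ∧ₚ ψ ⇒ ψ ∧ₚ φ)
  ax-⊥     : ∀ {φ} → Γ ⊢G (⊥ₚ ⇒ φ)
  ax-lem   : ∀ {φ} → Γ ⊢G (φ ∨ₚ ¬ₚ φ)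
  ax-¬⇒    : ∀ {φ} → Γ ⊢G (¬ₚ φ ⇒ (φ ⇒ ⊥ₚ))
  ax-⇒¬    : ∀ {φ} → Γ ⊢G ((φ ⇒ ⊥ₚ) ⇒ ¬ₚ φ)
  ax-∃in   : ∀ {φ x y} → FreeFor x y φ → Γ ⊢G (Subf x y φ ⇒ ex x φ)
  ax-∀el   : ∀ {φ x y} → FreeFor x y φ → Γ ⊢G (all x φ ⇒ Subf x y φ)
  ax-prop⊥r : ∀ {φ} → Γ ⊢G (φ · ⊥ₚ ⇒ ⊥ₚ)
  ax-prop⊥l : ∀ {φ} → Γ ⊢G (⊥ₚ · φ ⇒ ⊥ₚ)
  ax-prop∨l : ∀ {φ ψ χ} → Γ ⊢G ((φ ∨ₚ ψ) · χ ⇒ φ · χ ∨ₚ ψ · χ)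
  ax-prop∨r : ∀ {φ ψ χ} → Γ ⊢G (χ · (φ ∨ₚ ψ) ⇒ χ · φ ∨ₚ χ · ψ)
  ax-prop∃l : ∀ {φ ψ x} → ¬ (x occursIn ψ) → Γ ⊢G ((ex x φ) · ψ ⇒ ex x (φ · ψ))
  ax-prop∃r : ∀ {φ ψ x} → ¬ (x occursIn ψ) → Γ ⊢G (ψ · (ex x φ) ⇒ ex x (ψ · φ))
  r-mp     : ∀ {φ ψ} → Γ ⊢G φ → Γ ⊢G (φ ⇒ ψ) → Γ ⊢G ψ
  r-syl    : ∀ {φ ψ χ} → Γ ⊢G (φ ⇒ ψ) → Γ ⊢G (ψ ⇒ χ) → Γ ⊢G (φ ⇒ χ)
  r-exp    : ∀ {φ ψ χ} → Γ ⊢G (φ ∧ₚ ψ ⇒ χ) → Γ ⊢G (φ ⇒ (ψ ⇒ χ))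
  r-imp    : ∀ {φ ψ χ} → Γ ⊢G (φ ⇒ (ψ ⇒ χ)) → Γ ⊢G (φ ∧ₚ ψ ⇒ χ)
  r-exp∨   : ∀ {φ ψ χ} → Γ ⊢G (φ ⇒ ψ) → Γ ⊢G (χ ∨ₚ φ ⇒ χ ∨ₚ ψ)
  r-∃      : ∀ {φ ψ x} → ¬ (x ∈FV ψ) → Γ ⊢G (φ ⇒ ψ) → Γ ⊢G (ex x φ ⇒ ψ)
  r-∀      : ∀ {φ ψ x} → ¬ (x ∈FV φ) → Γ ⊢G (φ ⇒ ψ) → Γ ⊢G (φ ⇒ all x ψ)
  r-framel : ∀ {φ ψ χ} → Γ ⊢G (φ ⇒ ψ) → Γ ⊢G (φ · χ ⇒ ψ · χ)
  r-framer : ∀ {φ ψ χ} → Γ ⊢G (φ ⇒ ψ) → Γ ⊢G (χ · φ ⇒ χ · ψ)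

data _⊢P_ {C : Set} (Γ : Pattern C → Set) : Pattern C → Set where
  hyp      : ∀ {φ} → Γ φ → Γ ⊢P φ
  ax-K     : ∀ {φ ψ} → Γ ⊢P (φ ⇒ (ψ ⇒ φ))
  ax-S     : ∀ {φ ψ χ} → Γ ⊢P ((φ ⇒ (ψ ⇒ χ)) ⇒ ((φ ⇒ ψ) ⇒ (φ ⇒ χ)))
  ax-¬¬    : ∀ {φ} → Γ ⊢P (¬ₚ ¬ₚ φ ⇒ φ)
  ax-¬⇒    : ∀ {φ} → Γ ⊢P (¬ₚ φ ⇒ (φ ⇒ ⊥ₚ))
  ax-⇒¬    : ∀ {φ} → Γ ⊢P ((φ ⇒ ⊥ₚ) ⇒ ¬ₚ φ)
  ax-∨⇒    : ∀ {φ ψ} → Γ ⊢P (φ ∨ₚ ψ ⇒ (¬ₚ φ ⇒ ψ))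
  ax-⇒∨    : ∀ {φ ψ} → Γ ⊢P ((¬ₚ φ ⇒ ψ) ⇒ φ ∨ₚ ψ)
  ax-∧⇒    : ∀ {φ ψ} → Γ ⊢P (φ ∧ₚ ψ ⇒ ¬ₚ (¬ₚ φ ∨ₚ ¬ₚ ψ))
  ax-⇒∧    : ∀ {φ ψ} → Γ ⊢P (¬ₚ (¬ₚ φ ∨ₚ ¬ₚ ψ) ⇒ φ ∧ₚ ψ)
  ax-∃in   : ∀ {φ x y} → FreeFor x y φ → Γ ⊢P (Subf x y φ ⇒ ex x φ)
  ax-∀⇒    : ∀ {φ x} → Γ ⊢P (all x φ ⇒ ¬ₚ ex x (¬ₚ φ))
  ax-⇒∀    : ∀ {φ x} → Γ ⊢P (¬ₚ ex x (¬ₚ φ) ⇒ all x φ)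
  ax-prop⊥r : ∀ {φ} → Γ ⊢P (φ · ⊥ₚ ⇒ ⊥ₚ)
  ax-prop⊥l : ∀ {φ} → Γ ⊢P (⊥ₚ · φ ⇒ ⊥ₚ)
  ax-prop∨l : ∀ {φ ψ χ} → Γ ⊢P ((φ ∨ₚ ψ) · χ ⇒ φ · χ ∨ₚ ψ · χ)
  ax-prop∨r : ∀ {φ ψ χ} → Γ ⊢P (χ · (φ ∨ₚ ψ) ⇒ χ · φ ∨ₚ χ · ψ)
  ax-prop∃l : ∀ {φ ψ x} → ¬ (x ∈FV ψ) → Γ ⊢P ((ex x φ) · ψ ⇒ ex x (φ · ψ))
  ax-prop∃r : ∀ {φ ψ x} → ¬ (x ∈FV ψ) → Γ ⊢P (ψ · (ex x φ) ⇒ ex x (ψ · φ))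
  r-mp     : ∀ {φ ψ} → Γ ⊢P φ → Γ ⊢P (φ ⇒ ψ) → Γ ⊢P ψ
  r-∃      : ∀ {φ ψ x} → ¬ (x ∈FV ψ) → Γ ⊢P (φ ⇒ ψ) → Γ ⊢P (ex x φ ⇒ ψ)
  r-framel : ∀ {φ ψ χ} → Γ ⊢P (φ ⇒ ψ) → Γ ⊢P (φ · χ ⇒ ψ · χ)
  r-framer : ∀ {φ ψ χ} → Γ ⊢P (φ ⇒ ψ) → Γ ⊢P (χ · φ ⇒ χ · ψ)

{-# OPTIONS --safe #-}
module Submission where

-- Both systems prove modus ponens, K and S, hence a deduction theorem, so derivations in
-- either can be written in natural-deduction style; both also prove the classical laws of
-- ⊥, ¬, ∧ and ∨.  Every axiom and rule of one system then becomes a short derivation in the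
-- other, the quantifiers corresponding through ∀x φ ↔ ¬∃x¬φ.  The one real mismatch is the
-- side condition of ∃-propagation: 𝒢ᶜ needs x not to occur in ψ at all, 𝒫 only not free.
-- 𝒢ᶜ bridges it by renaming the bound variable of ∃x φ to a variable fresh for φ and ψ,
-- propagating, and renaming back.

open import Defs
open import Data.Empty using (⊥-elim)
open import Data.List using (List; []; _∷_)
open import Data.List.Membership.Propositional using (_∈_)
open import Data.List.Relation.Unary.Any using (here; there)
open import Data.Nat using (ℕ; suc; _≤_; _⊔_; _≟_)
open import Data.Nat.Properties using (≤-refl; ≤-trans; m≤m⊔n; m≤n⊔m; 1+n≰n)
open import Data.Product using (_,_)
open import Data.Sum using (inj₁; inj₂)
open import Data.Unit using (tt)
open import Function using (_∘_)
open import Function.Bundles using (_⇔_; mk⇔)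
open import Relation.Nullary using (¬_; yes; no)
open import Relation.Binary.PropositionalEquality using (_≡_; _≢_; refl; sym; cong; cong₂; subst)

private variable
  C : Set
  x y : EVar
  φ ψ χ φ₀ φ₁ φ₂ φ₃ : Pattern C
  Δ : List (Pattern C)
  Th Γ : Pattern C → Set

free⇒occurs : x ∈FV φ → x occursIn φ
free⇒occurs fv-var = oc-var
free⇒occurs (fv-¬ h) = oc-¬ (free⇒occurs h)
free⇒occurs (fv-⇒l h) = oc-⇒l (free⇒occurs h)
free⇒occurs (fv-⇒r h) = oc-⇒r (free⇒occurs h)
free⇒occurs (fv-∧l h) = oc-∧l (free⇒occurs h)
free⇒occurs (fv-∧r h) = oc-∧r (free⇒occurs h)
free⇒occurs (fv-∨l h) = oc-∨l (free⇒occurs h)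
free⇒occurs (fv-∨r h) = oc-∨r (free⇒occurs h)
free⇒occurs (fv-·l h) = oc-·l (free⇒occurs h)
free⇒occurs (fv-·r h) = oc-·r (free⇒occurs h)
free⇒occurs (fv-all _ h) = oc-all (free⇒occurs h)
free⇒occurs (fv-ex _ h) = oc-ex (free⇒occurs h)

Subf-notFree : (φ : Pattern C) → ¬ (x ∈FV φ) → Subf x y φ ≡ φ
Subf-notFree {x = x} (var z) n with x ≟ z
... | yes refl = ⊥-elim (n fv-var)
... | no _ = refl
Subf-notFree (con c) n = refl
Subf-notFree ⊥ₚ n = refl
Subf-notFree (¬ₚ φ) n = cong ¬ₚ_ (Subf-notFree φ (n ∘ fv-¬))
Subf-notFree (φ ⇒ ψ) n = cong₂ _⇒_ (Subf-notFree φ (n ∘ fv-⇒l)) (Subf-notFree ψ (n ∘ fv-⇒r))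
Subf-notFree (φ ∧ₚ ψ) n = cong₂ _∧ₚ_ (Subf-notFree φ (n ∘ fv-∧l)) (Subf-notFree ψ (n ∘ fv-∧r))
Subf-notFree (φ ∨ₚ ψ) n = cong₂ _∨ₚ_ (Subf-notFree φ (n ∘ fv-∨l)) (Subf-notFree ψ (n ∘ fv-∨r))
Subf-notFree (φ · ψ) n = cong₂ _·_ (Subf-notFree φ (n ∘ fv-·l)) (Subf-notFree ψ (n ∘ fv-·r))
Subf-notFree {x = x} (all z φ) n with x ≟ z
... | yes _ = refl
... | no x≢z = cong (all z) (Subf-notFree φ (n ∘ fv-all (x≢z ∘ sym)))
Subf-notFree {x = x} (ex z φ) n with x ≟ z
... | yes _ = refl
... | no x≢z = cong (ex z) (Subf-notFree φ (n ∘ fv-ex (x≢z ∘ sym)))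

Subf-self : (φ : Pattern C) → Subf x x φ ≡ φ
Subf-self {x = x} (var z) with x ≟ z
... | yes x≡z = cong var x≡z
... | no _ = refl
Subf-self (con c) = refl
Subf-self ⊥ₚ = refl
Subf-self (¬ₚ φ) = cong ¬ₚ_ (Subf-self φ)
Subf-self (φ ⇒ ψ) = cong₂ _⇒_ (Subf-self φ) (Subf-self ψ)
Subf-self (φ ∧ₚ ψ) = cong₂ _∧ₚ_ (Subf-self φ) (Subf-self ψ)
Subf-self (φ ∨ₚ ψ) = cong₂ _∨ₚ_ (Subf-self φ) (Subf-self ψ)
Subf-self (φ · ψ) = cong₂ _·_ (Subf-self φ) (Subf-self ψ)
Subf-self {x = x} (all z φ) with x ≟ z
... | yes _ = refl
... | no _ = cong (all z) (Subf-self φ)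
Subf-self {x = x} (ex z φ) with x ≟ z
... | yes _ = refl
... | no _ = cong (ex z) (Subf-self φ)

Subf-inverse : (φ : Pattern C) → ¬ (y occursIn φ) → Subf y x (Subf x y φ) ≡ φ
Subf-inverse {y = y} {x = x} (var z) n with x ≟ z
... | no _ = Subf-notFree (var z) (n ∘ free⇒occurs)
... | yes refl with y ≟ y
...   | yes _ = refl
...   | no y≢y = ⊥-elim (y≢y refl)
Subf-inverse (con c) n = refl
Subf-inverse ⊥ₚ n = refl
Subf-inverse (¬ₚ φ) n = cong ¬ₚ_ (Subf-inverse φ (n ∘ oc-¬))
Subf-inverse (φ ⇒ ψ) n = cong₂ _⇒_ (Subf-inverse φ (n ∘ oc-⇒l)) (Subf-inverse ψ (n ∘ oc-⇒r))
Subf-inverse (φ ∧ₚ ψ) n = cong₂ _∧ₚ_ (Subf-inverse φ (n ∘ oc-∧l)) (Subf-inverse ψ (n ∘ oc-∧r))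
Subf-inverse (φ ∨ₚ ψ) n = cong₂ _∨ₚ_ (Subf-inverse φ (n ∘ oc-∨l)) (Subf-inverse ψ (n ∘ oc-∨r))
Subf-inverse (φ · ψ) n = cong₂ _·_ (Subf-inverse φ (n ∘ oc-·l)) (Subf-inverse ψ (n ∘ oc-·r))
Subf-inverse {y = y} {x = x} (all z φ) n with x ≟ z
... | yes _ = Subf-notFree (all z φ) (n ∘ free⇒occurs)
... | no _ with y ≟ z
...   | yes refl = ⊥-elim (n oc-allb)
...   | no _ = cong (all z) (Subf-inverse φ (n ∘ oc-all))
Subf-inverse {y = y} {x = x} (ex z φ) n with x ≟ z
... | yes _ = Subf-notFree (ex z φ) (n ∘ free⇒occurs)
... | no _ with y ≟ z
...   | yes refl = ⊥-elim (n oc-exb)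
...   | no _ = cong (ex z) (Subf-inverse φ (n ∘ oc-ex))

notFree-Subf : (φ : Pattern C) → x ≢ y → ¬ (x ∈FV Subf x y φ)
notFree-Subf {x = x} (var z) x≢y h with x ≟ z | h
... | yes _ | fv-var = x≢y refl
... | no x≢z | fv-var = x≢z refl
notFree-Subf (¬ₚ φ) x≢y (fv-¬ h) = notFree-Subf φ x≢y h
notFree-Subf (φ ⇒ ψ) x≢y (fv-⇒l h) = notFree-Subf φ x≢y h
notFree-Subf (φ ⇒ ψ) x≢y (fv-⇒r h) = notFree-Subf ψ x≢y h
notFree-Subf (φ ∧ₚ ψ) x≢y (fv-∧l h) = notFree-Subf φ x≢y h
notFree-Subf (φ ∧ₚ ψ) x≢y (fv-∧r h) = notFree-Subf ψ x≢y h
notFree-Subf (φ ∨ₚ ψ) x≢y (fv-∨l h) = notFree-Subf φ x≢y h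
notFree-Subf (φ ∨ₚ ψ) x≢y (fv-∨r h) = notFree-Subf ψ x≢y h
notFree-Subf (φ · ψ) x≢y (fv-·l h) = notFree-Subf φ x≢y h
notFree-Subf (φ · ψ) x≢y (fv-·r h) = notFree-Subf ψ x≢y h
notFree-Subf {x = x} (all z φ) x≢y h with x ≟ z | h
... | yes x≡z | fv-all z≢x _ = z≢x (sym x≡z)
... | no _ | fv-all _ h′ = notFree-Subf φ x≢y h′
notFree-Subf {x = x} (ex z φ) x≢y h with x ≟ z | h
... | yes x≡z | fv-ex z≢x _ = z≢x (sym x≡z)
... | no _ | fv-ex _ h′ = notFree-Subf φ x≢y h′

FreeFor-self : (φ : Pattern C) → FreeFor x x φ
FreeFor-self (var z) = tt
FreeFor-self (con c) = tt
FreeFor-self ⊥ₚ = tt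
FreeFor-self (¬ₚ φ) = FreeFor-self φ
FreeFor-self (φ ⇒ ψ) = FreeFor-self φ , FreeFor-self ψ
FreeFor-self (φ ∧ₚ ψ) = FreeFor-self φ , FreeFor-self ψ
FreeFor-self (φ ∨ₚ ψ) = FreeFor-self φ , FreeFor-self ψ
FreeFor-self (φ · ψ) = FreeFor-self φ , FreeFor-self ψ
FreeFor-self {x = x} (all z φ) with z ≟ x
... | yes z≡x = inj₁ z≡x
... | no z≢x = inj₂ (⊥-elim ∘ z≢x , FreeFor-self φ)
FreeFor-self {x = x} (ex z φ) with z ≟ x
... | yes z≡x = inj₁ z≡x
... | no z≢x = inj₂ (⊥-elim ∘ z≢x , FreeFor-self φ)

FreeFor-notFree : (φ : Pattern C) → ¬ (x ∈FV φ) → FreeFor x y φ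
FreeFor-notFree (var z) n = tt
FreeFor-notFree (con c) n = tt
FreeFor-notFree ⊥ₚ n = tt
FreeFor-notFree (¬ₚ φ) n = FreeFor-notFree φ (n ∘ fv-¬)
FreeFor-notFree (φ ⇒ ψ) n = FreeFor-notFree φ (n ∘ fv-⇒l) , FreeFor-notFree ψ (n ∘ fv-⇒r)
FreeFor-notFree (φ ∧ₚ ψ) n = FreeFor-notFree φ (n ∘ fv-∧l) , FreeFor-notFree ψ (n ∘ fv-∧r)
FreeFor-notFree (φ ∨ₚ ψ) n = FreeFor-notFree φ (n ∘ fv-∨l) , FreeFor-notFree ψ (n ∘ fv-∨r)
FreeFor-notFree (φ · ψ) n = FreeFor-notFree φ (n ∘ fv-·l) , FreeFor-notFree ψ (n ∘ fv-·r)
FreeFor-notFree {x = x} (all z φ) n with z ≟ x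
... | yes z≡x = inj₁ z≡x
... | no z≢x = inj₂ ((λ _ → n ∘ fv-all z≢x) , FreeFor-notFree φ (n ∘ fv-all z≢x))
FreeFor-notFree {x = x} (ex z φ) n with z ≟ x
... | yes z≡x = inj₁ z≡x
... | no z≢x = inj₂ ((λ _ → n ∘ fv-ex z≢x) , FreeFor-notFree φ (n ∘ fv-ex z≢x))

FreeFor-notOccurs : (φ : Pattern C) → ¬ (y occursIn φ) → FreeFor x y φ
FreeFor-notOccurs (var z) n = tt
FreeFor-notOccurs (con c) n = tt
FreeFor-notOccurs ⊥ₚ n = tt
FreeFor-notOccurs (¬ₚ φ) n = FreeFor-notOccurs φ (n ∘ oc-¬)
FreeFor-notOccurs (φ ⇒ ψ) n = FreeFor-notOccurs φ (n ∘ oc-⇒l) , FreeFor-notOccurs ψ (n ∘ oc-⇒r)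
FreeFor-notOccurs (φ ∧ₚ ψ) n = FreeFor-notOccurs φ (n ∘ oc-∧l) , FreeFor-notOccurs ψ (n ∘ oc-∧r)
FreeFor-notOccurs (φ ∨ₚ ψ) n = FreeFor-notOccurs φ (n ∘ oc-∨l) , FreeFor-notOccurs ψ (n ∘ oc-∨r)
FreeFor-notOccurs (φ · ψ) n = FreeFor-notOccurs φ (n ∘ oc-·l) , FreeFor-notOccurs ψ (n ∘ oc-·r)
FreeFor-notOccurs (all z φ) n = inj₂ ((λ { refl _ → n oc-allb }) , FreeFor-notOccurs φ (n ∘ oc-all))
FreeFor-notOccurs (ex z φ) n = inj₂ ((λ { refl _ → n oc-exb }) , FreeFor-notOccurs φ (n ∘ oc-ex))

FreeFor-inverse : (φ : Pattern C) → ¬ (y occursIn φ) → FreeFor y x (Subf x y φ)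
FreeFor-inverse {x = x} (var z) n with x ≟ z
... | yes _ = tt
... | no _ = tt
FreeFor-inverse (con c) n = tt
FreeFor-inverse ⊥ₚ n = tt
FreeFor-inverse (¬ₚ φ) n = FreeFor-inverse φ (n ∘ oc-¬)
FreeFor-inverse (φ ⇒ ψ) n = FreeFor-inverse φ (n ∘ oc-⇒l) , FreeFor-inverse ψ (n ∘ oc-⇒r)
FreeFor-inverse (φ ∧ₚ ψ) n = FreeFor-inverse φ (n ∘ oc-∧l) , FreeFor-inverse ψ (n ∘ oc-∧r)
FreeFor-inverse (φ ∨ₚ ψ) n = FreeFor-inverse φ (n ∘ oc-∨l) , FreeFor-inverse ψ (n ∘ oc-∨r)
FreeFor-inverse (φ · ψ) n = FreeFor-inverse φ (n ∘ oc-·l) , FreeFor-inverse ψ (n ∘ oc-·r)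
FreeFor-inverse {x = x} (all z φ) n with x ≟ z
... | yes _ = FreeFor-notFree (all z φ) (n ∘ free⇒occurs)
... | no x≢z = inj₂ (⊥-elim ∘ x≢z ∘ sym , FreeFor-inverse φ (n ∘ oc-all))
FreeFor-inverse {x = x} (ex z φ) n with x ≟ z
... | yes _ = FreeFor-notFree (ex z φ) (n ∘ free⇒occurs)
... | no x≢z = inj₂ (⊥-elim ∘ x≢z ∘ sym , FreeFor-inverse φ (n ∘ oc-ex))

maxVar : Pattern C → ℕ
maxVar (var x) = x
maxVar (con c) = 0
maxVar ⊥ₚ = 0
maxVar (¬ₚ φ) = maxVar φ
maxVar (φ ⇒ ψ) = maxVar φ ⊔ maxVar ψ
maxVar (φ ∧ₚ ψ) = maxVar φ ⊔ maxVar ψ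
maxVar (φ ∨ₚ ψ) = maxVar φ ⊔ maxVar ψ
maxVar (φ · ψ) = maxVar φ ⊔ maxVar ψ
maxVar (all x φ) = x ⊔ maxVar φ
maxVar (ex x φ) = x ⊔ maxVar φ

occurs⇒≤maxVar : x occursIn φ → x ≤ maxVar φ
occurs⇒≤maxVar oc-var = ≤-refl
occurs⇒≤maxVar (oc-¬ h) = occurs⇒≤maxVar h
occurs⇒≤maxVar (oc-⇒l h) = ≤-trans (occurs⇒≤maxVar h) (m≤m⊔n _ _)
occurs⇒≤maxVar (oc-⇒r h) = ≤-trans (occurs⇒≤maxVar h) (m≤n⊔m _ _)
occurs⇒≤maxVar (oc-∧l h) = ≤-trans (occurs⇒≤maxVar h) (m≤m⊔n _ _)
occurs⇒≤maxVar (oc-∧r h) = ≤-trans (occurs⇒≤maxVar h) (m≤n⊔m _ _)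
occurs⇒≤maxVar (oc-∨l h) = ≤-trans (occurs⇒≤maxVar h) (m≤m⊔n _ _)
occurs⇒≤maxVar (oc-∨r h) = ≤-trans (occurs⇒≤maxVar h) (m≤n⊔m _ _)
occurs⇒≤maxVar (oc-·l h) = ≤-trans (occurs⇒≤maxVar h) (m≤m⊔n _ _)
occurs⇒≤maxVar (oc-·r h) = ≤-trans (occurs⇒≤maxVar h) (m≤n⊔m _ _)
occurs⇒≤maxVar oc-allb = m≤m⊔n _ _
occurs⇒≤maxVar oc-exb = m≤m⊔n _ _
occurs⇒≤maxVar (oc-all h) = ≤-trans (occurs⇒≤maxVar h) (m≤n⊔m _ _)
occurs⇒≤maxVar (oc-ex h) = ≤-trans (occurs⇒≤maxVar h) (m≤n⊔m _ _)

fresh : Pattern C → EVar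
fresh φ = suc (maxVar φ)

fresh-notOccurs : (φ : Pattern C) → ¬ (fresh φ occursIn φ)
fresh-notOccurs φ = 1+n≰n ∘ occurs⇒≤maxVar

fresh-∃-notOccurs : (x : EVar) (φ : Pattern C) → ¬ (fresh (ex x φ) occursIn φ)
fresh-∃-notOccurs x φ = fresh-notOccurs (ex x φ) ∘ oc-ex

fresh-∃-≢ : (x : EVar) (φ : Pattern C) → fresh (ex x φ) ≢ x
fresh-∃-≢ x φ z≡x = fresh-notOccurs (ex x φ) (subst (_occursIn ex x φ) (sym z≡x) oc-exb)

record IsHilbert {C : Set} (Th : Pattern C → Set) : Set where
  field
    mp : Th φ → Th (φ ⇒ ψ) → Th ψ
    K  : Th (φ ⇒ ψ ⇒ φ)
    S  : Th ((φ ⇒ ψ ⇒ χ) ⇒ (φ ⇒ ψ) ⇒ φ ⇒ χ)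

data ND {C : Set} (Th : Pattern C → Set) (Δ : List (Pattern C)) : Pattern C → Set where
  thm : Th φ → ND Th Δ φ
  asm : φ ∈ Δ → ND Th Δ φ
  lam : ND Th (φ ∷ Δ) ψ → ND Th Δ (φ ⇒ ψ)
  app : ND Th Δ (φ ⇒ ψ) → ND Th Δ φ → ND Th Δ ψ

#0 : ND Th (φ₀ ∷ Δ) φ₀
#0 = asm (here refl)

#1 : ND Th (φ₀ ∷ φ₁ ∷ Δ) φ₁
#1 = asm (there (here refl))

#2 : ND Th (φ₀ ∷ φ₁ ∷ φ₂ ∷ Δ) φ₂
#2 = asm (there (there (here refl)))

#3 : ND Th (φ₀ ∷ φ₁ ∷ φ₂ ∷ φ₃ ∷ Δ) φ₃
#3 = asm (there (there (there (here refl))))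

infixr 3 _⇛_
_⇛_ : List (Pattern C) → Pattern C → Pattern C
[] ⇛ ψ = ψ
(φ ∷ Δ) ⇛ ψ = Δ ⇛ φ ⇒ ψ

module Hilbert {C : Set} {Th : Pattern C → Set} (H : IsHilbert Th) where
  open IsHilbert H public

  ⇒-refl : Th (φ ⇒ φ)
  ⇒-refl {φ = φ} = mp (K {ψ = φ}) (mp (K {ψ = φ ⇒ φ}) S)

  ⇒-lift : Th (φ ⇒ ψ) → Th ((χ ⇒ φ) ⇒ χ ⇒ ψ)
  ⇒-lift f = mp (mp f K) S

  ⇒-trans : Th (φ ⇒ ψ) → Th (ψ ⇒ χ) → Th (φ ⇒ χ)
  ⇒-trans f g = mp f (⇒-lift g)

  ⇛-weaken : ∀ Δ → Th ψ → Th (Δ ⇛ ψ)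
  ⇛-weaken [] t = t
  ⇛-weaken (_ ∷ Δ) t = ⇛-weaken Δ (mp t K)

  ⇛-map : ∀ Δ → Th (φ ⇒ ψ) → Th (Δ ⇛ φ) → Th (Δ ⇛ ψ)
  ⇛-map [] f t = mp t f
  ⇛-map (_ ∷ Δ) f t = ⇛-map Δ (⇒-lift f) t

  ⇛-map₂ : ∀ Δ → Th (φ ⇒ ψ ⇒ χ) → Th (Δ ⇛ φ) → Th (Δ ⇛ ψ) → Th (Δ ⇛ χ)
  ⇛-map₂ [] f s t = mp t (mp s f)
  ⇛-map₂ (_ ∷ Δ) f s t = ⇛-map₂ Δ (⇒-trans (⇒-lift f) S) s t

  ⇛-assumption : ∀ Δ → φ ∈ Δ → Th (Δ ⇛ φ)
  ⇛-assumption (_ ∷ Δ) (here refl) = ⇛-weaken Δ ⇒-refl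
  ⇛-assumption (_ ∷ Δ) (there i) = ⇛-map Δ K (⇛-assumption Δ i)

  deduction : ∀ Δ → ND Th Δ φ → Th (Δ ⇛ φ)
  deduction Δ (thm t) = ⇛-weaken Δ t
  deduction Δ (asm i) = ⇛-assumption Δ i
  deduction Δ (lam d) = deduction (_ ∷ Δ) d
  deduction Δ (app d e) = ⇛-map₂ Δ ⇒-refl (deduction Δ d) (deduction Δ e)

  closed : ND Th [] φ → Th φ
  closed = deduction []

record IsClassical {C : Set} (Th : Pattern C → Set) : Set where
  field
    isHilbert       : IsHilbert Th
    explosion       : Th (⊥ₚ ⇒ φ)
    ¬-⇒⊥            : Th (¬ₚ φ ⇒ φ ⇒ ⊥ₚ)
    ⇒⊥-¬            : Th ((φ ⇒ ⊥ₚ) ⇒ ¬ₚ φ)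
    excluded-middle : Th (φ ∨ₚ ¬ₚ φ)
    ∧-pair          : Th (φ ⇒ ψ ⇒ φ ∧ₚ ψ)
    ∧-fst           : Th (φ ∧ₚ ψ ⇒ φ)
    ∧-snd           : Th (φ ∧ₚ ψ ⇒ ψ)
    ∨-inl           : Th (φ ⇒ φ ∨ₚ ψ)
    ∨-inr           : Th (ψ ⇒ φ ∨ₚ ψ)
    ∨-case          : Th (φ ∨ₚ ψ ⇒ (φ ⇒ χ) ⇒ (ψ ⇒ χ) ⇒ χ)

module Classical {C : Set} {Th : Pattern C → Set} (CL : IsClassical Th) where
  open IsClassical CL public
  open Hilbert isHilbert public

  ⊥e : ND Th Δ ⊥ₚ → ND Th Δ φ
  ⊥e d = app (thm explosion) d

  ¬e : ND Th Δ (¬ₚ φ) → ND Th Δ φ → ND Th Δ ⊥ₚ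
  ¬e d e = app (app (thm ¬-⇒⊥) d) e

  ¬i : ND Th (φ ∷ Δ) ⊥ₚ → ND Th Δ (¬ₚ φ)
  ¬i d = app (thm ⇒⊥-¬) (lam d)

  ∧i : ND Th Δ φ → ND Th Δ ψ → ND Th Δ (φ ∧ₚ ψ)
  ∧i d e = app (app (thm ∧-pair) d) e

  ∧e₁ : ND Th Δ (φ ∧ₚ ψ) → ND Th Δ φ
  ∧e₁ d = app (thm ∧-fst) d

  ∧e₂ : ND Th Δ (φ ∧ₚ ψ) → ND Th Δ ψ
  ∧e₂ d = app (thm ∧-snd) d

  ∨i₁ : ND Th Δ φ → ND Th Δ (φ ∨ₚ ψ)
  ∨i₁ d = app (thm ∨-inl) d

  ∨i₂ : ND Th Δ ψ → ND Th Δ (φ ∨ₚ ψ)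
  ∨i₂ d = app (thm ∨-inr) d

  ∨e : ND Th Δ (φ ∨ₚ ψ) → ND Th (φ ∷ Δ) χ → ND Th (ψ ∷ Δ) χ → ND Th Δ χ
  ∨e d e₁ e₂ = app (app (app (thm ∨-case) d) (lam e₁)) (lam e₂)

  raa : ND Th (¬ₚ φ ∷ Δ) ⊥ₚ → ND Th Δ φ
  raa d = ∨e (thm excluded-middle) #0 (⊥e d)

⊢P-isHilbert : IsHilbert (Γ ⊢P_)
⊢P-isHilbert = record { mp = r-mp ; K = ax-K ; S = ax-S }

module _ {C : Set} {Γ : Pattern C → Set} where
  private
    P = Γ ⊢P_
    open Hilbert (⊢P-isHilbert {Γ = Γ})

    explosion : P (⊥ₚ ⇒ φ)
    explosion = closed (lam (app (thm ax-¬¬) (app (thm ax-⇒¬) (app (thm ax-K) #0))))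

    ⊥e : ND P Δ ⊥ₚ → ND P Δ φ
    ⊥e d = app (thm explosion) d

    ¬e : ND P Δ (¬ₚ φ) → ND P Δ φ → ND P Δ ⊥ₚ
    ¬e d e = app (app (thm ax-¬⇒) d) e

    ¬i : ND P (φ ∷ Δ) ⊥ₚ → ND P Δ (¬ₚ φ)
    ¬i d = app (thm ax-⇒¬) (lam d)

    raa : ND P (¬ₚ φ ∷ Δ) ⊥ₚ → ND P Δ φ
    raa d = app (thm ax-¬¬) (¬i d)

  ⊢P-isClassical : IsClassical P
  ⊢P-isClassical = record
    { isHilbert = ⊢P-isHilbert
    ; explosion = explosion
    ; ¬-⇒⊥ = ax-¬⇒
    ; ⇒⊥-¬ = ax-⇒¬
    ; excluded-middle = r-mp ⇒-refl ax-⇒∨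
    ; ∧-pair = closed (lam (lam (app (thm ax-⇒∧)
        (¬i (¬e (app (app (thm ax-∨⇒) #0) (¬i (¬e #0 #3))) #1)))))
    ; ∧-fst = closed (lam (raa (¬e (app (thm ax-∧⇒) #1) (app (thm ax-⇒∨) (lam (⊥e (¬e #0 #1)))))))
    ; ∧-snd = closed (lam (raa (¬e (app (thm ax-∧⇒) #1) (app (thm ax-⇒∨) (lam #1)))))
    ; ∨-inl = closed (lam (app (thm ax-⇒∨) (lam (⊥e (¬e #0 #1)))))
    ; ∨-inr = closed (lam (app (thm ax-⇒∨) (lam #1)))
    ; ∨-case = closed (lam (lam (lam (raa (¬e #0 (app #1
        (app (app (thm ax-∨⇒) #3) (¬i (¬e #1 (app #3 #0))))))))))
    }

⊢G-refl : Γ ⊢G (φ ⇒ φ)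
⊢G-refl = r-syl ax-∧dup ax-∧el

-- 𝒢ᶜ has no K or S; they come from currying (r-exp, r-imp) and duplication φ ⇒ φ ∧ φ.
⊢G-mp-under : Γ ⊢G (χ ⇒ φ) → Γ ⊢G (χ ⇒ φ ⇒ ψ) → Γ ⊢G (χ ⇒ ψ)
⊢G-mp-under h f = r-syl ax-∧dup (r-imp (r-syl h (r-exp (r-syl ax-∧comm (r-imp f)))))

⊢G-∧-snd : Γ ⊢G (φ ∧ₚ ψ ⇒ ψ)
⊢G-∧-snd = r-syl ax-∧comm ax-∧el

⊢G-S : Γ ⊢G ((φ ⇒ ψ ⇒ χ) ⇒ (φ ⇒ ψ) ⇒ φ ⇒ χ)
⊢G-S = r-exp (r-exp (⊢G-mp-under (⊢G-mp-under π₃ π₂) (⊢G-mp-under π₃ π₁)))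
  where
  π₁ = r-syl ax-∧el ax-∧el
  π₂ = r-syl ax-∧el ⊢G-∧-snd
  π₃ = ⊢G-∧-snd

⊢G-isHilbert : IsHilbert (Γ ⊢G_)
⊢G-isHilbert = record { mp = r-mp ; K = r-exp ax-∧el ; S = ⊢G-S }

⊢G-∨-case : Γ ⊢G (φ ⇒ χ) → Γ ⊢G (ψ ⇒ χ) → Γ ⊢G (φ ∨ₚ ψ ⇒ χ)
⊢G-∨-case f g = r-syl (r-exp∨ g) (r-syl ax-∨comm (r-syl (r-exp∨ f) ax-∨idem))

⊢G-isClassical : IsClassical (Γ ⊢G_)
⊢G-isClassical = record
  { isHilbert = ⊢G-isHilbert
  ; explosion = ax-⊥
  ; ¬-⇒⊥ = ax-¬⇒
  ; ⇒⊥-¬ = ax-⇒¬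
  ; excluded-middle = ax-lem
  ; ∧-pair = r-exp ⊢G-refl
  ; ∧-fst = ax-∧el
  ; ∧-snd = ⊢G-∧-snd
  ; ∨-inl = ax-∨in
  ; ∨-inr = r-syl ax-∨in ax-∨comm
  ; ∨-case = ⊢G-∨-case (closed (lam (lam (lam (app #1 #2))))) (closed (lam (lam (lam (app #0 #2)))))
  }
  where open Hilbert ⊢G-isHilbert

module _ {C : Set} {Γ : Pattern C → Set} where
  open Classical (⊢P-isClassical {Γ = Γ})

  ⊢P-∀-elim : FreeFor x y φ → Γ ⊢P (all x φ ⇒ Subf x y φ)
  ⊢P-∀-elim {φ = φ} ff =
    closed (lam (raa (¬e (app (thm ax-∀⇒) #1) (app (thm (ax-∃in {φ = ¬ₚ φ} ff)) #0))))

  ⊢P-∀-intro : ¬ (x ∈FV φ) → Γ ⊢P (φ ⇒ ψ) → Γ ⊢P (φ ⇒ all x ψ)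
  ⊢P-∀-intro {x = x} {φ = φ} {ψ = ψ} x∉φ f =
    closed (lam (app (thm ax-⇒∀) (¬i (¬e (app (thm ∃¬ψ⇒¬φ) #0) #1))))
    where
    ∃¬ψ⇒¬φ : Γ ⊢P (ex x (¬ₚ ψ) ⇒ ¬ₚ φ)
    ∃¬ψ⇒¬φ = r-∃ (λ { (fv-¬ h) → x∉φ h }) (closed (lam (¬i (¬e #1 (app (thm f) #0)))))

  ⊢G⇒⊢P : Γ ⊢G φ → Γ ⊢P φ
  ⊢G⇒⊢P (hyp h) = hyp h
  ⊢G⇒⊢P ax-∨idem = closed (lam (∨e #0 #0 #0))
  ⊢G⇒⊢P ax-∧dup = closed (lam (∧i #0 #0))
  ⊢G⇒⊢P ax-∨in = ∨-inl
  ⊢G⇒⊢P ax-∧el = ∧-fst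
  ⊢G⇒⊢P ax-∨comm = closed (lam (∨e #0 (∨i₂ #0) (∨i₁ #0)))
  ⊢G⇒⊢P ax-∧comm = closed (lam (∧i (∧e₂ #0) (∧e₁ #0)))
  ⊢G⇒⊢P ax-⊥ = explosion
  ⊢G⇒⊢P ax-lem = excluded-middle
  ⊢G⇒⊢P ax-¬⇒ = ax-¬⇒
  ⊢G⇒⊢P ax-⇒¬ = ax-⇒¬
  ⊢G⇒⊢P (ax-∃in ff) = ax-∃in ff
  ⊢G⇒⊢P (ax-∀el ff) = ⊢P-∀-elim ff
  ⊢G⇒⊢P ax-prop⊥r = ax-prop⊥r
  ⊢G⇒⊢P ax-prop⊥l = ax-prop⊥l
  ⊢G⇒⊢P ax-prop∨l = ax-prop∨l
  ⊢G⇒⊢P ax-prop∨r = ax-prop∨r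
  ⊢G⇒⊢P (ax-prop∃l x∉ψ) = ax-prop∃l (x∉ψ ∘ free⇒occurs)
  ⊢G⇒⊢P (ax-prop∃r x∉ψ) = ax-prop∃r (x∉ψ ∘ free⇒occurs)
  ⊢G⇒⊢P (r-mp d e) = r-mp (⊢G⇒⊢P d) (⊢G⇒⊢P e)
  ⊢G⇒⊢P (r-syl d e) = closed (lam (app (thm (⊢G⇒⊢P e)) (app (thm (⊢G⇒⊢P d)) #0)))
  ⊢G⇒⊢P (r-exp d) = closed (lam (lam (app (thm (⊢G⇒⊢P d)) (∧i #1 #0))))
  ⊢G⇒⊢P (r-imp d) = closed (lam (app (app (thm (⊢G⇒⊢P d)) (∧e₁ #0)) (∧e₂ #0)))
  ⊢G⇒⊢P (r-exp∨ d) = closed (lam (∨e #0 (∨i₁ #0) (∨i₂ (app (thm (⊢G⇒⊢P d)) #0))))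
  ⊢G⇒⊢P (r-∃ x∉ψ d) = r-∃ x∉ψ (⊢G⇒⊢P d)
  ⊢G⇒⊢P (r-∀ x∉φ d) = ⊢P-∀-intro x∉φ (⊢G⇒⊢P d)
  ⊢G⇒⊢P (r-framel d) = r-framel (⊢G⇒⊢P d)
  ⊢G⇒⊢P (r-framer d) = r-framer (⊢G⇒⊢P d)

⊢G-∀-elim-self : (φ : Pattern C) → Γ ⊢G (all x φ ⇒ φ)
⊢G-∀-elim-self {Γ = Γ} {x = x} φ =
  subst (λ t → Γ ⊢G (all x φ ⇒ t)) (Subf-self φ) (ax-∀el {y = x} (FreeFor-self φ))

⊢G-∃-intro-self : (φ : Pattern C) → Γ ⊢G (φ ⇒ ex x φ)
⊢G-∃-intro-self {Γ = Γ} {x = x} φ =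
  subst (λ t → Γ ⊢G (t ⇒ ex x φ)) (Subf-self φ) (ax-∃in {y = x} (FreeFor-self φ))

⊢G-∃-rename : (φ : Pattern C) → ¬ (y occursIn φ) → y ≢ x → Γ ⊢G (ex x φ ⇒ ex y (Subf x y φ))
⊢G-∃-rename {y = y} {x = x} {Γ = Γ} φ y∉φ y≢x =
  r-∃ (λ { (fv-ex _ h) → notFree-Subf φ (y≢x ∘ sym) h })
      (subst (λ t → Γ ⊢G (t ⇒ ex y (Subf x y φ))) (Subf-inverse φ y∉φ)
             (ax-∃in (FreeFor-inverse φ y∉φ)))

⊢G-∃-unrename : (φ : Pattern C) → ¬ (y occursIn φ) → y ≢ x → Γ ⊢G (ex y (Subf x y φ) ⇒ ex x φ)
⊢G-∃-unrename φ y∉φ y≢x =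
  r-∃ (λ { (fv-ex _ h) → y∉φ (free⇒occurs h) }) (ax-∃in (FreeFor-notOccurs φ y∉φ))

⊢G-prop∃l : (φ ψ : Pattern C) → ¬ (x ∈FV ψ) → Γ ⊢G (ex x φ · ψ ⇒ ex x (φ · ψ))
⊢G-prop∃l {x = x} {Γ = Γ} φ ψ x∉ψ =
  r-syl (r-framel (⊢G-∃-rename φ (z∉φψ ∘ oc-·l) z≢x)) (r-syl (ax-prop∃l (z∉φψ ∘ oc-·r)) back)
  where
  z = fresh (ex x (φ · ψ))
  z∉φψ = fresh-∃-notOccurs x (φ · ψ)
  z≢x = fresh-∃-≢ x (φ · ψ)
  back : Γ ⊢G (ex z (Subf x z φ · ψ) ⇒ ex x (φ · ψ))
  back = subst (λ t → Γ ⊢G (ex z (Subf x z φ · t) ⇒ ex x (φ · ψ))) (Subf-notFree ψ x∉ψ)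
               (⊢G-∃-unrename (φ · ψ) z∉φψ z≢x)

⊢G-prop∃r : (φ ψ : Pattern C) → ¬ (x ∈FV ψ) → Γ ⊢G (ψ · ex x φ ⇒ ex x (ψ · φ))
⊢G-prop∃r {x = x} {Γ = Γ} φ ψ x∉ψ =
  r-syl (r-framer (⊢G-∃-rename φ (z∉ψφ ∘ oc-·r) z≢x)) (r-syl (ax-prop∃r (z∉ψφ ∘ oc-·l)) back)
  where
  z = fresh (ex x (ψ · φ))
  z∉ψφ = fresh-∃-notOccurs x (ψ · φ)
  z≢x = fresh-∃-≢ x (ψ · φ)
  back : Γ ⊢G (ex z (ψ · Subf x z φ) ⇒ ex x (ψ · φ))
  back = subst (λ t → Γ ⊢G (ex z (t · Subf x z φ) ⇒ ex x (ψ · φ))) (Subf-notFree ψ x∉ψ)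
               (⊢G-∃-unrename (ψ · φ) z∉ψφ z≢x)

module _ {C : Set} {Γ : Pattern C → Set} where
  open Classical (⊢G-isClassical {Γ = Γ})

  ⊢G-∀⇒¬∃¬ : (φ : Pattern C) → Γ ⊢G (all x φ ⇒ ¬ₚ ex x (¬ₚ φ))
  ⊢G-∀⇒¬∃¬ {x = x} φ = closed (lam (¬i (app (app (thm ∃¬φ⇒∀φ⇒⊥) #0) #1)))
    where
    ∃¬φ⇒∀φ⇒⊥ : Γ ⊢G (ex x (¬ₚ φ) ⇒ all x φ ⇒ ⊥ₚ)
    ∃¬φ⇒∀φ⇒⊥ = r-∃ (λ { (fv-⇒l (fv-all x≢x _)) → x≢x refl })
                   (closed (lam (lam (¬e #1 (app (thm (⊢G-∀-elim-self φ)) #0)))))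

  ⊢G-¬∃¬⇒∀ : (φ : Pattern C) → Γ ⊢G (¬ₚ ex x (¬ₚ φ) ⇒ all x φ)
  ⊢G-¬∃¬⇒∀ φ = r-∀ (λ { (fv-¬ (fv-ex x≢x _)) → x≢x refl })
                   (closed (lam (raa (¬e #1 (app (thm (⊢G-∃-intro-self (¬ₚ φ))) #0)))))

  ⊢P⇒⊢G : Γ ⊢P φ → Γ ⊢G φ
  ⊢P⇒⊢G (hyp h) = hyp h
  ⊢P⇒⊢G ax-K = K
  ⊢P⇒⊢G ax-S = S
  ⊢P⇒⊢G ax-¬¬ = closed (lam (raa (¬e #1 #0)))
  ⊢P⇒⊢G ax-¬⇒ = ax-¬⇒
  ⊢P⇒⊢G ax-⇒¬ = ax-⇒¬
  ⊢P⇒⊢G ax-∨⇒ = closed (lam (lam (∨e #1 (⊥e (¬e #1 #0)) #0)))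
  ⊢P⇒⊢G ax-⇒∨ = closed (lam (∨e (thm excluded-middle) (∨i₁ #0) (∨i₂ (app #1 #0))))
  ⊢P⇒⊢G ax-∧⇒ = closed (lam (¬i (∨e #0 (¬e #0 (∧e₁ #2)) (¬e #0 (∧e₂ #2)))))
  ⊢P⇒⊢G ax-⇒∧ = closed (lam (∧i (raa (¬e #1 (∨i₁ #0))) (raa (¬e #1 (∨i₂ #0)))))
  ⊢P⇒⊢G (ax-∃in ff) = ax-∃in ff
  ⊢P⇒⊢G (ax-∀⇒ {φ}) = ⊢G-∀⇒¬∃¬ φ
  ⊢P⇒⊢G (ax-⇒∀ {φ}) = ⊢G-¬∃¬⇒∀ φ
  ⊢P⇒⊢G ax-prop⊥r = ax-prop⊥r
  ⊢P⇒⊢G ax-prop⊥l = ax-prop⊥l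
  ⊢P⇒⊢G ax-prop∨l = ax-prop∨l
  ⊢P⇒⊢G ax-prop∨r = ax-prop∨r
  ⊢P⇒⊢G (ax-prop∃l {φ} {ψ} x∉ψ) = ⊢G-prop∃l φ ψ x∉ψ
  ⊢P⇒⊢G (ax-prop∃r {φ} {ψ} x∉ψ) = ⊢G-prop∃r φ ψ x∉ψ
  ⊢P⇒⊢G (r-mp d e) = r-mp (⊢P⇒⊢G d) (⊢P⇒⊢G e)
  ⊢P⇒⊢G (r-∃ x∉ψ d) = r-∃ x∉ψ (⊢P⇒⊢G d)
  ⊢P⇒⊢G (r-framel d) = r-framel (⊢P⇒⊢G d)
  ⊢P⇒⊢G (r-framer d) = r-framer (⊢P⇒⊢G d)

mainTheorem1 : {C : Set} (Γ : Pattern C → Set) (φ : Pattern C) →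
    (Γ ⊢G φ) ⇔ (Γ ⊢P φ)
mainTheorem1 Γ φ = mk⇔ ⊢G⇒⊢P ⊢P⇒⊢G
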